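{- For every positive integer $m$, \[ \ell(m)\leq \frac{5+\sqrt{9+24m}}{2}. \]
   Context: $J$ is the graph (with loops) on three vertices $a,b,c$ whose edges are $ab$ and a loop at $b$; $c$ is an isolated unlooped vertex. For a simple graph $G$, $j(G)$ denotes the number of maps $\phi:V(G)\to V(J)$ with $\phi(x)\phi(y)\in E(J)$ whenever $xy\in E(G)$. A graph with $n$ vertices and $m$ edges is $J$-extremal if $j(G)\geq j(G')$ for every simple graph $G'$ with $n$ vertices and $m$ edges. The lexicographic order on subsets of $[q]$ is $A<B$ iff $\min(A\triangle B)\in A$; the lex graph $L(q,m)$ has vertex set $[q]$ and edge set the first $m$ two-element subsets of $[q]$ in this order. $E_r$ is the edgeless graph on $r$ vertices. For integers $n,q,m$ with $q\le\min\{n,m+1\}$ and $0\le m\le\binom q2$, $R(n,q;m)=L(q,m)\cup E_{n-q}$ (disjoint union). Then $\ell(m)=\max\{q : R(m+1,q;m)\text{ is }J\text{ -extremal}\}$, the maximum over admissible $q$. -}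

module Defs where

open import Data.Bool using (Bool; true; false; _∧_; _∨_; not; _xor_; if_then_else_)
open import Data.Nat using (ℕ; zero; suc; _+_; _<ᵇ_)
open import Data.Fin using (Fin; toℕ; splitAt)
open import Data.Fin.Properties using (_≟_)
open import Data.Fin.Subset using (Subset; ⁅_⁆; _∪_)
open import Data.Fin.Subset.Properties using (∪-comm)
open import Data.List using (List; []; _∷_; map; concatMap; cartesianProduct; allFin; foldr)
open import Data.Vec using (Vec; []; _∷_)
import Data.Vec.Functional as VF
open import Data.Product using (_×_; _,_; proj₁; proj₂)
open import Data.Sum using (_⊎_; inj₁; inj₂)
open import Relation.Nullary using (yes; no; does)
open import Relation.Binary.PropositionalEquality using (_≡_; refl; sym; cong)

record SimpleGraph (n : ℕ) : Set where
  field
    adj    : Fin n → Fin n → Bool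
    adjSym : ∀ i j → adj i j ≡ adj j i
    irrefl : ∀ i → adj i i ≡ false
open SimpleGraph public

count : {A : Set} → (A → Bool) → List A → ℕ
count p = foldr (λ x k → if p x then suc k else k) 0

allPairs : (n : ℕ) → List (Fin n × Fin n)
allPairs n = cartesianProduct (allFin n) (allFin n)

edgeCount : {n : ℕ} → SimpleGraph n → ℕ
edgeCount {n} G = count (λ p → (toℕ (proj₁ p) <ᵇ toℕ (proj₂ p)) ∧ adj G (proj₁ p) (proj₂ p)) (allPairs n)

data JV : Set where
  a b c : JV

Jadj : JV → JV → Bool
Jadj a b = true
Jadj b a = true
Jadj b b = true
Jadj _ _ = false

allMaps : (n : ℕ) → List (Fin n → JV)
allMaps zero    = (λ ()) ∷ []
allMaps (suc n) = concatMap (λ v → map (λ f → v VF.∷ f) (allMaps n)) (a ∷ b ∷ c ∷ [])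

allᵇ : {A : Set} → (A → Bool) → List A → Bool
allᵇ p = foldr (λ x k → p x ∧ k) true

isHom : {n : ℕ} → SimpleGraph n → (Fin n → JV) → Bool
isHom {n} G φ = allᵇ (λ p → not (adj G (proj₁ p) (proj₂ p)) ∨ Jadj (φ (proj₁ p)) (φ (proj₂ p))) (allPairs n)

jHom : {n : ℕ} → SimpleGraph n → ℕ
jHom {n} G = count (isHom G) (allMaps n)

IsJExtremal : {n : ℕ} → SimpleGraph n → Set
IsJExtremal {n} G = (G' : SimpleGraph n) → edgeCount G' ≡ edgeCount G → jHom G' Data.Nat.≤ jHom G

-- Lexicographic order on subsets of Fin q (vertex 0 is the least element):
-- A < B iff min (A △ B) ∈ A.

lexLess : {k : ℕ} → Vec Bool k → Vec Bool k → Bool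
lexLess []       []       = false
lexLess (x ∷ xs) (y ∷ ys) = if x xor y then x else lexLess xs ys

twoSubsets : (q : ℕ) → List (Subset q)
twoSubsets q = map (λ p → ⁅ proj₁ p ⁆ ∪ ⁅ proj₂ p ⁆)
  (Data.List.filterᵇ (λ p → toℕ (proj₁ p) <ᵇ toℕ (proj₂ p)) (allPairs q))

lexRank : {q : ℕ} → Subset q → ℕ
lexRank {q} A = count (λ B → lexLess B A) (twoSubsets q)

neqᵇ : {q : ℕ} → Fin q → Fin q → Bool
neqᵇ i j = not (does (i ≟ j))

neqᵇ-sym : {q : ℕ} (i j : Fin q) → neqᵇ i j ≡ neqᵇ j i
neqᵇ-sym i j with i ≟ j | j ≟ i
... | yes _ | yes _ = refl
... | no _  | no _  = refl
... | yes p | no q  with q (sym p)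
... | ()
neqᵇ-sym i j | no p | yes q with p (sym q)
... | ()

neqᵇ-irr : {q : ℕ} (i : Fin q) → neqᵇ i i ≡ false
neqᵇ-irr i with i ≟ i
... | yes _ = refl
... | no p with p refl
... | ()

lexAdj : (q m : ℕ) → Fin q → Fin q → Bool
lexAdj q m i j = neqᵇ i j ∧ (lexRank (⁅ i ⁆ ∪ ⁅ j ⁆) <ᵇ m)

L : (q m : ℕ) → SimpleGraph q
L q m = record
  { adj    = lexAdj q m
  ; adjSym = λ i j → cong₂' (neqᵇ-sym i j) (cong (λ S → lexRank S <ᵇ m) (∪-comm ⁅ i ⁆ ⁅ j ⁆))
  ; irrefl = λ i → cong (_∧ (lexRank (⁅ i ⁆ ∪ ⁅ i ⁆) <ᵇ m)) (neqᵇ-irr i)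
  }
  where
  cong₂' : ∀ {x y u v : Bool} → x ≡ y → u ≡ v → (x ∧ u) ≡ (y ∧ v)
  cong₂' refl refl = refl

E : (r : ℕ) → SimpleGraph r
E r = record { adj = λ _ _ → false ; adjSym = λ _ _ → refl ; irrefl = λ _ → refl }

duAdj : {p r : ℕ} → SimpleGraph p → SimpleGraph r → Fin (p + r) → Fin (p + r) → Bool
duAdj {p} G H i j with splitAt p i | splitAt p j
... | inj₁ x | inj₁ y = adj G x y
... | inj₂ x | inj₂ y = adj H x y
... | _      | _      = false

duSym : {p r : ℕ} (G : SimpleGraph p) (H : SimpleGraph r) (i j : Fin (p + r)) →
        duAdj G H i j ≡ duAdj G H j i
duSym {p} G H i j with splitAt p i | splitAt p j
... | inj₁ x | inj₁ y = adjSym G x y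
... | inj₂ x | inj₂ y = adjSym H x y
... | inj₁ x | inj₂ y = refl
... | inj₂ x | inj₁ y = refl

duIrr : {p r : ℕ} (G : SimpleGraph p) (H : SimpleGraph r) (i : Fin (p + r)) →
        duAdj G H i i ≡ false
duIrr {p} G H i with splitAt p i
... | inj₁ x = irrefl G x
... | inj₂ x = irrefl H x

_⊔G_ : {p r : ℕ} → SimpleGraph p → SimpleGraph r → SimpleGraph (p + r)
G ⊔G H = record { adj = duAdj G H ; adjSym = duSym G H ; irrefl = duIrr G H }

-- R(n,q;m) = L(q,m) ∪ E_{n-q}  (on q + (n ∸ q) vertices, which is n when q ≤ n)
R : (n q m : ℕ) → SimpleGraph (q + (n Data.Nat.∸ q))
R n q m = L q m ⊔G E (n Data.Nat.∸ q)

-- In a homomorphism G → J only isolated vertices can go to c, the vertices sent to a form an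
-- independent set and all others go to b; so j(G) counts independent sets, with a factor 3 for
-- each isolated vertex.  Writing m = F(q, k) + r, where F(q, k) counts the pairs of [q] meeting
-- the first k vertices, L(q, m) is a threshold graph: k dominating vertices, then vertex k joined
-- to the next r vertices and missing the last s ≥ 1.  Hence
--     j(R(m + 1, q; m)) = (k + 2^s + 2^(r + s)) · 3^(m + 1 - q).
-- If q ≥ 3k + 5, another threshold graph with m edges on q - 2 vertices (the same k with a larger
-- r, or k + 1 dominating vertices) beats R once padded with two extra isolated vertices, which
-- contribute the factor 9.  Otherwise q ≤ 3k + 4, and m ≥ F(q, k) = kq - k(k + 1)/2 gives the
-- bound directly (as does m ≥ F(q, q) = q(q - 1)/2 when L(q, m) is complete).

module Submission where

open import Defs
open import Data.Bool using (Bool; true; false; _∧_; _∨_; not)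
open import Data.Bool.Properties using (∧-assoc; ∧-zeroʳ; ∧-identityʳ; ∨-identityʳ; ∨-zeroʳ; ∨-comm; ∨-idem)
open import Data.Empty using (⊥-elim)
open import Data.Fin using (Fin; zero; suc; toℕ; fromℕ<; splitAt; _≟_)
open import Data.Fin.Properties using (toℕ-fromℕ<; toℕ<n; toℕ-injective; toℕ-↑ˡ; toℕ-↑ʳ; splitAt⁻¹-↑ˡ; splitAt⁻¹-↑ʳ)
open import Data.Fin.Subset using (Subset; ⁅_⁆; _∪_; ⊥)
open import Data.Fin.Subset.Properties using (∪-identityˡ)
open import Data.List using (List; []; _∷_; _++_; map; concatMap; tabulate; filterᵇ; allFin; cartesianProduct)
open import Data.List.Membership.Propositional using (_∈_)
open import Data.List.Membership.Propositional.Properties using (∈-cartesianProduct⁺; ∈-allFin)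
open import Data.List.Properties using (tabulate-cong)
open import Data.List.Relation.Unary.Any using (here; there)
open import Data.Nat using (ℕ; zero; suc; _+_; _*_; _∸_; _^_; _⊔_; _≤_; _<_; _<ᵇ_; _≡ᵇ_; z≤n; s≤s; _≤?_; _<?_)
open import Data.Nat.ListAction using (sum; product)
open import Data.Nat.Properties hiding (_≟_)
open import Data.Nat.Combinatorics using (_C_)
open import Data.Nat.Tactic.RingSolver using (solve-∀)
open import Data.Product using (_×_; _,_; proj₁; proj₂)
open import Data.Sum using (inj₁; inj₂)
open import Data.Vec using (Vec; []; _∷_)
import Data.Vec.Functional as VF
open import Relation.Binary.Definitions using (tri<; tri≈; tri>)
open import Relation.Binary.PropositionalEquality
open import Relation.Nullary using (¬_; yes; no)

count-++ : {A : Set} (p : A → Bool) (xs ys : List A) → count p (xs ++ ys) ≡ count p xs + count p ys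
count-++ p []       ys = refl
count-++ p (x ∷ xs) ys with p x
... | true  = cong suc (count-++ p xs ys)
... | false = count-++ p xs ys

count-map : {A B : Set} (p : B → Bool) (f : A → B) (xs : List A) → count p (map f xs) ≡ count (λ x → p (f x)) xs
count-map p f []       = refl
count-map p f (x ∷ xs) with p (f x)
... | true  = cong suc (count-map p f xs)
... | false = count-map p f xs

count-concatMap : {A B : Set} (p : B → Bool) (f : A → List B) (xs : List A) →
  count p (concatMap f xs) ≡ sum (map (λ x → count p (f x)) xs)
count-concatMap p f []       = refl
count-concatMap p f (x ∷ xs) = trans (count-++ p (f x) _) (cong (count p (f x) +_) (count-concatMap p f xs))

count-cong : {A : Set} {p q : A → Bool} → (∀ x → p x ≡ q x) → (xs : List A) → count p xs ≡ count q xs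
count-cong p≗q []       = refl
count-cong {p = p} {q} p≗q (x ∷ xs) with p x | q x | p≗q x
... | true  | true  | refl = cong suc (count-cong p≗q xs)
... | false | false | refl = count-cong p≗q xs

count-none : {A : Set} {p : A → Bool} → (∀ x → p x ≡ false) → (xs : List A) → count p xs ≡ 0
count-none p≡false []       = refl
count-none {p = p} p≡false (x ∷ xs) rewrite p≡false x = count-none p≡false xs

count-filterᵇ : {A : Set} (p q : A → Bool) (xs : List A) → count p (filterᵇ q xs) ≡ count (λ x → q x ∧ p x) xs
count-filterᵇ p q []       = refl
count-filterᵇ p q (x ∷ xs) with q x
... | false = count-filterᵇ p q xs
... | true with p x
...   | true  = cong suc (count-filterᵇ p q xs)
...   | false = count-filterᵇ p q xs

indicator : Bool → ℕ
indicator true  = 1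
indicator false = 0

count-tabulate : {A : Set} {n : ℕ} (p : A → Bool) (g : Fin n → A) →
                 count p (tabulate g) ≡ sum (tabulate (λ i → indicator (p (g i))))
count-tabulate {n = zero}  p g = refl
count-tabulate {n = suc n} p g with p (g zero)
... | true  = cong suc (count-tabulate p (λ i → g (suc i)))
... | false = count-tabulate p (λ i → g (suc i))

count-cartesianProduct : {A B : Set} {n : ℕ} (p : A × B → Bool) (g : Fin n → A) (ys : List B) →
  count p (cartesianProduct (tabulate g) ys) ≡ sum (tabulate (λ i → count (λ y → p (g i , y)) ys))
count-cartesianProduct {n = zero}  p g ys = refl
count-cartesianProduct {n = suc n} p g ys = trans (count-++ p (map (g zero ,_) ys) _)
  (cong₂ _+_ (count-map p (g zero ,_) ys) (count-cartesianProduct p (λ i → g (suc i)) ys))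

sum-tabulate-cong : ∀ n {f g : Fin n → ℕ} → (∀ i → f i ≡ g i) → sum (tabulate f) ≡ sum (tabulate g)
sum-tabulate-cong n f≗g = cong sum (tabulate-cong f≗g)

sum-tabulate-zero : (n : ℕ) → sum (tabulate {n = n} (λ _ → 0)) ≡ 0
sum-tabulate-zero zero    = refl
sum-tabulate-zero (suc n) = sum-tabulate-zero n

sum-indicator-<ᵇ : ∀ n x → x ≤ n → sum (tabulate {n = n} (λ j → indicator (toℕ j <ᵇ x))) ≡ x
sum-indicator-<ᵇ n       zero    _         = sum-tabulate-zero n
sum-indicator-<ᵇ (suc n) (suc x) (s≤s x≤n) = cong suc (sum-indicator-<ᵇ n x x≤n)

edgeless : ∀ {n} → Fin n → Fin n → Bool
edgeless _ _ = false

countPairs : (n : ℕ) → (Fin n → Fin n → Bool) → ℕ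
countPairs n A = sum (tabulate λ i → sum (tabulate λ j → indicator ((toℕ i <ᵇ toℕ j) ∧ A i j)))

count-allPairs : ∀ n (A : Fin n → Fin n → Bool) →
  count (λ p → (toℕ (proj₁ p) <ᵇ toℕ (proj₂ p)) ∧ A (proj₁ p) (proj₂ p)) (allPairs n) ≡ countPairs n A
count-allPairs n A = trans (count-cartesianProduct {n = n} _ (λ i → i) (allFin n))
  (sum-tabulate-cong n (λ i → count-tabulate {n = n} (λ j → (toℕ i <ᵇ toℕ j) ∧ A i j) (λ j → j)))

edgeCount≡countPairs : ∀ {n} (G : SimpleGraph n) → edgeCount G ≡ countPairs n (adj G)
edgeCount≡countPairs {n} G = count-allPairs n (adj G)

<ᵇ≡true⇒< : ∀ x y → (x <ᵇ y) ≡ true → x < y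
<ᵇ≡true⇒< zero    (suc y) _  = s≤s z≤n
<ᵇ≡true⇒< (suc x) (suc y) eq = s≤s (<ᵇ≡true⇒< x y eq)

<⇒<ᵇ≡true : ∀ {x y} → x < y → (x <ᵇ y) ≡ true
<⇒<ᵇ≡true {zero}  (s≤s _)   = refl
<⇒<ᵇ≡true {suc x} (s≤s x<y) = <⇒<ᵇ≡true x<y

≥⇒<ᵇ≡false : ∀ {x y} → y ≤ x → (x <ᵇ y) ≡ false
≥⇒<ᵇ≡false {x}     {zero}  _         = refl
≥⇒<ᵇ≡false {suc x} {suc y} (s≤s y≤x) = ≥⇒<ᵇ≡false y≤x

countPairs-cong : ∀ n {A B : Fin n → Fin n → Bool} → (∀ i j → toℕ i < toℕ j → A i j ≡ B i j) →
                  countPairs n A ≡ countPairs n B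
countPairs-cong n {A} {B} A≈B = sum-tabulate-cong n (λ i → sum-tabulate-cong n (entry i))
  where
  entry : ∀ i j → indicator ((toℕ i <ᵇ toℕ j) ∧ A i j) ≡ indicator ((toℕ i <ᵇ toℕ j) ∧ B i j)
  entry i j with toℕ i <ᵇ toℕ j in i<j
  ... | true  = cong indicator (A≈B i j (<ᵇ≡true⇒< _ _ i<j))
  ... | false = refl

countPairs-empty : ∀ n → countPairs n edgeless ≡ 0
countPairs-empty n = trans (sum-tabulate-cong n λ i → trans (sum-tabulate-cong n λ j → cong indicator (∧-zeroʳ (toℕ i <ᵇ toℕ j)))
                                                         (sum-tabulate-zero n))
                           (sum-tabulate-zero n)

∧-true : {x y : Bool} → (x ∧ y) ≡ true → x ≡ true × y ≡ true
∧-true {true} {true} _ = refl , refl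

∧-intro : {x y : Bool} → x ≡ true → y ≡ true → (x ∧ y) ≡ true
∧-intro refl refl = refl

∧-absorbˡ : (x y : Bool) → (x ≡ true → y ≡ true) → (x ∧ y) ≡ x
∧-absorbˡ true  y x⇒y = x⇒y refl
∧-absorbˡ false y _   = refl

⇒ᵇ-elim : {x y : Bool} → (not x ∨ y) ≡ true → x ≡ true → y ≡ true
⇒ᵇ-elim {true} {true} _ _ = refl

⇒ᵇ-intro : {x y : Bool} → (x ≡ true → y ≡ true) → (not x ∨ y) ≡ true
⇒ᵇ-intro {true}  x⇒y = x⇒y refl
⇒ᵇ-intro {false} _   = refl

allFinᵇ : (n : ℕ) → (Fin n → Bool) → Bool
allFinᵇ zero    p = true
allFinᵇ (suc n) p = p zero ∧ allFinᵇ n (λ i → p (suc i))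

allFinᵇ-elim : ∀ n {p : Fin n → Bool} → allFinᵇ n p ≡ true → ∀ i → p i ≡ true
allFinᵇ-elim (suc n) all zero    = proj₁ (∧-true all)
allFinᵇ-elim (suc n) all (suc i) = allFinᵇ-elim n (proj₂ (∧-true all)) i

allFinᵇ-intro : ∀ n {p : Fin n → Bool} → (∀ i → p i ≡ true) → allFinᵇ n p ≡ true
allFinᵇ-intro zero    _   = refl
allFinᵇ-intro (suc n) all = ∧-intro (all zero) (allFinᵇ-intro n (λ i → all (suc i)))

allFinᵇ-cong : ∀ n {p q : Fin n → Bool} → (∀ i → p i ≡ q i) → allFinᵇ n p ≡ allFinᵇ n q
allFinᵇ-cong zero    _   = refl
allFinᵇ-cong (suc n) p≗q = cong₂ _∧_ (p≗q zero) (allFinᵇ-cong n (λ i → p≗q (suc i)))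

allFinᵇ-∧ : ∀ n (p q : Fin n → Bool) → (allFinᵇ n p ∧ allFinᵇ n q) ≡ allFinᵇ n (λ i → p i ∧ q i)
allFinᵇ-∧ zero    p q = refl
allFinᵇ-∧ (suc n) p q with p zero | q zero
... | true  | true  = allFinᵇ-∧ n (λ i → p (suc i)) (λ i → q (suc i))
... | true  | false = ∧-zeroʳ _
... | false | _     = refl

allFinᵇ-false : ∀ n {p : Fin n → Bool} (i : Fin n) → p i ≡ false → allFinᵇ n p ≡ false
allFinᵇ-false (suc n) {p} zero    pi≡false rewrite pi≡false = refl
allFinᵇ-false (suc n) {p} (suc i) pi≡false with p zero
... | true  = allFinᵇ-false n i pi≡false
... | false = refl

-- Homomorphisms into J

Jadj-sym : ∀ u v → Jadj u v ≡ Jadj v u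
Jadj-sym a a = refl
Jadj-sym a b = refl
Jadj-sym a c = refl
Jadj-sym b a = refl
Jadj-sym b b = refl
Jadj-sym b c = refl
Jadj-sym c a = refl
Jadj-sym c b = refl
Jadj-sym c c = refl

IsHomomorphism : {n : ℕ} → (Fin n → Fin n → Bool) → (Fin n → JV) → Set
IsHomomorphism A f = ∀ i j → A i j ≡ true → Jadj (f i) (f j) ≡ true

-- isHom, recursively: checking the edges at vertex 0 first lets counting peel that vertex off.
homᵇ : (n : ℕ) → (Fin n → Fin n → Bool) → (Fin n → JV) → Bool
homᵇ zero    A f = true
homᵇ (suc n) A f = allFinᵇ n (λ j → not (A zero (suc j)) ∨ Jadj (f zero) (f (suc j)))
                   ∧ homᵇ n (λ i j → A (suc i) (suc j)) (λ i → f (suc i))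

homᵇ-cong : ∀ n {A B : Fin n → Fin n → Bool} → (∀ i j → A i j ≡ B i j) → (f : Fin n → JV) → homᵇ n A f ≡ homᵇ n B f
homᵇ-cong zero    A≈B f = refl
homᵇ-cong (suc n) A≈B f = cong₂ _∧_ (allFinᵇ-cong n (λ j → cong (λ x → not x ∨ _) (A≈B zero (suc j))))
                                    (homᵇ-cong n (λ i j → A≈B (suc i) (suc j)) (λ i → f (suc i)))

homᵇ-complete : ∀ n {A : Fin n → Fin n → Bool} (f : Fin n → JV) → IsHomomorphism A f → homᵇ n A f ≡ true
homᵇ-complete zero    f hom = refl
homᵇ-complete (suc n) f hom = ∧-intro (allFinᵇ-intro n (λ j → ⇒ᵇ-intro (hom zero (suc j))))
                                      (homᵇ-complete n (λ i → f (suc i)) (λ i j → hom (suc i) (suc j)))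

homᵇ-sound : ∀ n {A : Fin n → Fin n → Bool} → (∀ i j → A i j ≡ A j i) → (∀ i → A i i ≡ false) →
             (f : Fin n → JV) → homᵇ n A f ≡ true → IsHomomorphism A f
homᵇ-sound (suc n) sym-A irr-A f hom zero    zero    A00 with () ← trans (sym (irr-A zero)) A00
homᵇ-sound (suc n) sym-A irr-A f hom zero    (suc j) A0j = ⇒ᵇ-elim (allFinᵇ-elim n (proj₁ (∧-true hom)) j) A0j
homᵇ-sound (suc n) sym-A irr-A f hom (suc i) zero    Ai0 =
  trans (Jadj-sym (f (suc i)) (f zero)) (⇒ᵇ-elim (allFinᵇ-elim n (proj₁ (∧-true hom)) i) (trans (sym-A zero (suc i)) Ai0))
homᵇ-sound (suc n) sym-A irr-A f hom (suc i) (suc j) Aij =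
  homᵇ-sound n (λ i j → sym-A (suc i) (suc j)) (λ i → irr-A (suc i)) (λ i → f (suc i)) (proj₂ (∧-true hom)) i j Aij

allᵇ-elim : {A : Set} {p : A → Bool} (xs : List A) → allᵇ p xs ≡ true → ∀ {x} → x ∈ xs → p x ≡ true
allᵇ-elim (y ∷ xs) all (here refl) = proj₁ (∧-true all)
allᵇ-elim (y ∷ xs) all (there x∈xs) = allᵇ-elim xs (proj₂ (∧-true all)) x∈xs

allᵇ-intro : {A : Set} {p : A → Bool} (xs : List A) → (∀ x → p x ≡ true) → allᵇ p xs ≡ true
allᵇ-intro []       _   = refl
allᵇ-intro (y ∷ xs) all = ∧-intro (all y) (allᵇ-intro xs all)

Bool-ext : {x y : Bool} → (x ≡ true → y ≡ true) → (y ≡ true → x ≡ true) → x ≡ y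
Bool-ext {true}  {true}  _   _   = refl
Bool-ext {false} {false} _   _   = refl
Bool-ext {true}  {false} x⇒y _   = sym (x⇒y refl)
Bool-ext {false} {true}  _   y⇒x = y⇒x refl

isHom≡homᵇ : ∀ {n} (G : SimpleGraph n) (φ : Fin n → JV) → isHom G φ ≡ homᵇ n (adj G) φ
isHom≡homᵇ {n} G φ = Bool-ext
  (λ all → homᵇ-complete n φ (λ i j Gij →
     ⇒ᵇ-elim (allᵇ-elim (allPairs n) all (∈-cartesianProduct⁺ (∈-allFin i) (∈-allFin j))) Gij))
  (λ hom → allᵇ-intro (allPairs n) (λ p →
     ⇒ᵇ-intro (homᵇ-sound n (adjSym G) (irrefl G) φ hom (proj₁ p) (proj₂ p))))

homsWith : (n : ℕ) → (Fin n → Fin n → Bool) → (Fin n → JV → Bool) → ℕ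
homsWith n A P = count (λ f → allFinᵇ n (λ i → P i (f i)) ∧ homᵇ n A f) (allMaps n)

jHom≡homsWith : ∀ {n} (G : SimpleGraph n) → jHom G ≡ homsWith n (adj G) (λ _ _ → true)
jHom≡homsWith {n} G = count-cong (λ φ → trans (isHom≡homᵇ G φ)
  (cong (_∧ homᵇ n (adj G) φ) (sym (allFinᵇ-intro n (λ _ → refl))))) (allMaps n)

homsWith-cong : ∀ n {A B : Fin n → Fin n → Bool} {P Q : Fin n → JV → Bool} →
  (∀ i j → A i j ≡ B i j) → (∀ i v → P i v ≡ Q i v) → homsWith n A P ≡ homsWith n B Q
homsWith-cong n A≈B P≈Q = count-cong
  (λ f → cong₂ _∧_ (allFinᵇ-cong n (λ i → P≈Q i (f i))) (homᵇ-cong n A≈B f)) (allMaps n)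

homsWith-blocked : ∀ n (A : Fin n → Fin n → Bool) (P : Fin n → JV → Bool) (i : Fin n) →
  (∀ v → P i v ≡ false) → homsWith n A P ≡ 0
homsWith-blocked n A P i blocked =
  count-none (λ f → cong (_∧ homᵇ n A f) (allFinᵇ-false n i (blocked (f i)))) (allMaps n)

-- Sending vertex 0 to v constrains each neighbour of vertex 0 to a neighbour of v.
homsWithHead : (n : ℕ) → (Fin (suc n) → Fin (suc n) → Bool) → (Fin (suc n) → JV → Bool) → JV → ℕ
homsWithHead n A P v = indicator (P zero v) *
  homsWith n (λ i j → A (suc i) (suc j)) (λ j w → P (suc j) w ∧ (not (A zero (suc j)) ∨ Jadj v w))

homsWithHead-count : ∀ n A P v →
  count (λ g → allFinᵇ (suc n) (λ i → P i ((v VF.∷ g) i)) ∧ homᵇ (suc n) A (v VF.∷ g)) (allMaps n)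
  ≡ homsWithHead n A P v
homsWithHead-count n A P v with P zero v
... | false = count-none (λ _ → refl) (allMaps n)
... | true  = trans (count-cong (λ g → trans (sym (∧-assoc (allFinᵇ n _) _ _)) (cong (_∧ _) (allFinᵇ-∧ n _ _)))
                                (allMaps n))
                    (sym (+-identityʳ _))

homsWith-suc : ∀ n A P → homsWith (suc n) A P ≡ homsWithHead n A P a + (homsWithHead n A P b + homsWithHead n A P c)
homsWith-suc n A P =
  trans (count-concatMap Q (λ v → map (v VF.∷_) (allMaps n)) (a ∷ b ∷ c ∷ []))
        (cong₂ _+_ (head a) (cong₂ _+_ (head b) (trans (+-identityʳ _) (head c))))
  where
  Q : (Fin (suc n) → JV) → Bool
  Q f = allFinᵇ (suc n) (λ i → P i (f i)) ∧ homᵇ (suc n) A f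
  head : ∀ v → count Q (map (v VF.∷_) (allMaps n)) ≡ homsWithHead n A P v
  head v = trans (count-map Q (v VF.∷_) (allMaps n)) (homsWithHead-count n A P v)

admissible : (JV → Bool) → ℕ
admissible p = indicator (p a) + (indicator (p b) + indicator (p c))

homsWith-edgeless : ∀ n (P : Fin n → JV → Bool) →
  homsWith n edgeless P ≡ product (tabulate (λ i → admissible (P i)))
homsWith-edgeless zero    P = refl
homsWith-edgeless (suc n) P = begin
  homsWith (suc n) edgeless P
    ≡⟨ homsWith-suc n edgeless P ⟩
  homsWithHead n edgeless P a + (homsWithHead n edgeless P b + homsWithHead n edgeless P c)
    ≡⟨ cong₂ _+_ (cong (indicator (P zero a) *_) (rest a)) (cong₂ _+_ (cong (indicator (P zero b) *_) (rest b))
                                                                      (cong (indicator (P zero c) *_) (rest c))) ⟩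
  indicator (P zero a) * Π + (indicator (P zero b) * Π + indicator (P zero c) * Π)
    ≡⟨ distrib (indicator (P zero a)) (indicator (P zero b)) (indicator (P zero c)) Π ⟩
  admissible (P zero) * Π ∎
  where
  open ≡-Reasoning
  Π = product (tabulate (λ i → admissible (P (suc i))))
  rest : ∀ v → homsWith n edgeless (λ j w → P (suc j) w ∧ (not false ∨ Jadj v w)) ≡ Π
  rest v = trans (homsWith-cong n (λ _ _ → refl) (λ j w → ∧-identityʳ (P (suc j) w))) (homsWith-edgeless n (λ j → P (suc j)))
  distrib : ∀ x y z w → x * w + (y * w + z * w) ≡ (x + (y + z)) * w
  distrib = solve-∀

allowed : (forceB avoidC : Bool) → JV → Bool
allowed forceB avoidC a = not forceB
allowed forceB avoidC b = true
allowed forceB avoidC c = not (forceB ∨ avoidC)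

restriction : {n : ℕ} → ℕ → ℕ → Fin n → JV → Bool
restriction x y i = allowed (toℕ i <ᵇ x) (toℕ i <ᵇ y)

restriction-forceB : ∀ {n x y} (i : Fin n) {v} → toℕ i < x → restriction x y i v ≡ true → v ≡ b
restriction-forceB {y = y} i {a} i<x ok with () ← trans (sym ok) (cong (λ u → allowed u (toℕ i <ᵇ y) a) (<⇒<ᵇ≡true i<x))
restriction-forceB         i {b} i<x ok = refl
restriction-forceB {y = y} i {c} i<x ok with () ← trans (sym ok) (cong (λ u → allowed u (toℕ i <ᵇ y) c) (<⇒<ᵇ≡true i<x))

<ᵇ-⊔ : ∀ i x y → ((i <ᵇ x) ∨ (i <ᵇ y)) ≡ (i <ᵇ (x ⊔ y))
<ᵇ-⊔ i       zero    y       = refl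
<ᵇ-⊔ i       (suc x) zero    = ∨-identityʳ _
<ᵇ-⊔ zero    (suc x) (suc y) = refl
<ᵇ-⊔ (suc i) (suc x) (suc y) = <ᵇ-⊔ i x y

allowed-∧ : ∀ p q p′ q′ v → (allowed p q v ∧ allowed p′ q′ v) ≡ allowed (p ∨ p′) (q ∨ q′) v
allowed-∧ true  q     p′ q′ a = refl
allowed-∧ false q     p′ q′ a = refl
allowed-∧ p     q     p′ q′ b = refl
allowed-∧ true  q     p′ q′ c = refl
allowed-∧ false true  p′ q′ c = cong not (sym (∨-zeroʳ p′))
allowed-∧ false false p′ q′ c = refl

restriction-∧ : ∀ {n} x y x′ y′ (i : Fin n) v →
  (restriction x y i v ∧ restriction x′ y′ i v) ≡ restriction (x ⊔ x′) (y ⊔ y′) i v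
restriction-∧ x y x′ y′ i v = trans (allowed-∧ _ _ _ _ v) (cong₂ (λ p q → allowed p q v) (<ᵇ-⊔ _ x x′) (<ᵇ-⊔ _ y y′))

neighbourOf-a : ∀ p w → (not p ∨ Jadj a w) ≡ allowed p p w
neighbourOf-a p a = ∨-identityʳ _
neighbourOf-a p b = ∨-zeroʳ _
neighbourOf-a p c = trans (∨-identityʳ _) (cong not (sym (∨-idem p)))

neighbourOf-b : ∀ p w → (not p ∨ Jadj b w) ≡ allowed false p w
neighbourOf-b p a = ∨-zeroʳ _
neighbourOf-b p b = ∨-zeroʳ _
neighbourOf-b p c = ∨-identityʳ _

neighbourOf-c : ∀ p w → (not p ∨ Jadj c w) ≡ not p
neighbourOf-c p a = ∨-identityʳ _
neighbourOf-c p b = ∨-identityʳ _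
neighbourOf-c p c = ∨-identityʳ _

product-admissible-restriction : ∀ x d e →
  product (tabulate {n = x + d + e} (λ i → admissible (restriction x (x + d) i))) ≡ 2 ^ d * 3 ^ e
product-admissible-restriction (suc x) d       e       = trans (+-identityʳ _) (product-admissible-restriction x d e)
product-admissible-restriction zero    (suc d) e       =
  trans (cong (2 *_) (product-admissible-restriction zero d e)) (sym (*-assoc 2 (2 ^ d) (3 ^ e)))
product-admissible-restriction zero    zero    zero    = refl
product-admissible-restriction zero    zero    (suc e) =
  trans (cong (3 *_) (trans (product-admissible-restriction zero zero e) (*-identityˡ _))) (sym (*-identityˡ _))

homsWith-edgeless-restriction : ∀ {n y} x d e → y ≡ x + d → n ≡ y + e →
  homsWith n edgeless (restriction x y) ≡ 2 ^ d * 3 ^ e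
homsWith-edgeless-restriction x d e refl refl =
  trans (homsWith-edgeless (x + d + e) (restriction x (x + d))) (product-admissible-restriction x d e)

homsWith-forcedB : ∀ n (A : Fin n → Fin n → Bool) x y → (∀ i j → A i j ≡ true → toℕ i < x × toℕ j < x) →
  homsWith n A (restriction x y) ≡ homsWith n edgeless (restriction x y)
homsWith-forcedB n A x y A<x = count-cong
  (λ f → trans (∧-absorbˡ _ _ (allB⇒hom f)) (sym (∧-absorbˡ _ _ (λ _ → homᵇ-complete n f (λ _ _ ())))))
  (allMaps n)
  where
  allB⇒hom : ∀ f → allFinᵇ n (λ i → restriction x y i (f i)) ≡ true → homᵇ n A f ≡ true
  allB⇒hom f ok = homᵇ-complete n f λ i j Aij →
    subst₂ (λ u v → Jadj u v ≡ true) (sym (isB i (proj₁ (A<x i j Aij)))) (sym (isB j (proj₂ (A<x i j Aij)))) refl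
    where
    isB : ∀ i → toℕ i < x → f i ≡ b
    isB i i<x = restriction-forceB {y = y} i i<x (allFinᵇ-elim n ok i)

restriction-∧-neighbourOf-a : ∀ {n} x y z {row : Fin n → Bool} → (∀ j → row j ≡ (toℕ j <ᵇ z)) → ∀ j w →
  (restriction x y j w ∧ (not (row j) ∨ Jadj a w)) ≡ restriction (x ⊔ z) (y ⊔ z) j w
restriction-∧-neighbourOf-a x y z row≡ j w =
  trans (cong (restriction x y j w ∧_) (trans (cong (λ p → not p ∨ Jadj a w) (row≡ j)) (neighbourOf-a _ w)))
        (restriction-∧ x y z z j w)

restriction-∧-neighbourOf-b : ∀ {n} x y z {row : Fin n → Bool} → (∀ j → row j ≡ (toℕ j <ᵇ z)) → ∀ j w →
  (restriction x y j w ∧ (not (row j) ∨ Jadj b w)) ≡ restriction x (y ⊔ z) j w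
restriction-∧-neighbourOf-b x y z row≡ j w =
  trans (cong (restriction x y j w ∧_) (trans (cong (λ p → not p ∨ Jadj b w) (row≡ j)) (neighbourOf-b _ w)))
        (trans (restriction-∧ x y 0 z j w) (cong (λ x′ → restriction x′ (y ⊔ z) j w) (⊔-identityʳ x)))

-- Threshold graphs

-- threshold t k r i j  iff  i < j < t  and  (i < k  or  i = k and j ≤ k + r):
-- the first k vertices are joined to all of [t], vertex k to the next r ones.
threshold : ℕ → ℕ → ℕ → ℕ → ℕ → Bool
threshold t       k       r zero    zero    = false
threshold t       k       r zero    (suc j) = (suc j <ᵇ t) ∧ ((0 <ᵇ k) ∨ (j <ᵇ r))
threshold t       zero    r (suc i) j       = false
threshold zero    (suc k) r (suc i) j       = false
threshold (suc t) (suc k) r (suc i) zero    = false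
threshold (suc t) (suc k) r (suc i) (suc j) = threshold t k r i j

threshold-< : ∀ t k r i j → threshold t k r i j ≡ true → i < j × j < t
threshold-< t       k       r zero    (suc j) edge = s≤s z≤n , <ᵇ≡true⇒< (suc j) t (proj₁ (∧-true edge))
threshold-< (suc t) (suc k) r (suc i) (suc j) edge with threshold-< t k r i j edge
... | i<j , j<t = s≤s i<j , s≤s j<t

threshold-≥ : ∀ t k r {i j} → j ≤ i → threshold t k r i j ≡ false
threshold-≥ t k r {i} {j} j≤i with threshold t k r i j in edge
... | false = refl
... | true  = ⊥-elim (<⇒≱ (proj₁ (threshold-< t k r i j edge)) j≤i)

thresholdAdj : ∀ {n} → ℕ → ℕ → ℕ → Fin n → Fin n → Bool
thresholdAdj t k r i j = threshold t k r (toℕ i) (toℕ j) ∨ threshold t k r (toℕ j) (toℕ i)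

thresholdAdj≡threshold : ∀ {n} t k r (i j : Fin n) → toℕ i < toℕ j → thresholdAdj t k r i j ≡ threshold t k r (toℕ i) (toℕ j)
thresholdAdj≡threshold t k r i j i<j =
  trans (cong (threshold t k r (toℕ i) (toℕ j) ∨_) (threshold-≥ t k r (<⇒≤ i<j))) (∨-identityʳ _)

thresholdAdj-sym : ∀ {n} t k r (i j : Fin n) → thresholdAdj t k r i j ≡ thresholdAdj t k r j i
thresholdAdj-sym t k r i j = ∨-comm (threshold t k r (toℕ i) (toℕ j)) _

thresholdAdj-irrefl : ∀ {n} t k r (i : Fin n) → thresholdAdj t k r i i ≡ false
thresholdAdj-irrefl t k r i rewrite threshold-≥ t k r (≤-refl {toℕ i}) = refl

Threshold : (n t k r : ℕ) → SimpleGraph n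
Threshold n t k r = record { adj = thresholdAdj t k r ; adjSym = thresholdAdj-sym t k r ; irrefl = thresholdAdj-irrefl t k r }

thresholdAdj-< : ∀ {n} t k r (i j : Fin n) → thresholdAdj t k r i j ≡ true → toℕ i < t × toℕ j < t
thresholdAdj-< t k r i j edge with threshold t k r (toℕ i) (toℕ j) in ij | threshold t k r (toℕ j) (toℕ i) in ji
... | true  | _    = let i<j , j<t = threshold-< t k r _ _ ij in <-trans i<j j<t , j<t
... | false | true = let j<i , i<t = threshold-< t k r _ _ ji in i<t , <-trans j<i i<t

thresholdAdj-beyond : ∀ {n} t k r (i j : Fin n) → t ≤ toℕ i → thresholdAdj t k r i j ≡ false
thresholdAdj-beyond t k r i j t≤i with thresholdAdj t k r i j in edge
... | false = refl
... | true  = ⊥-elim (<⇒≱ (proj₁ (thresholdAdj-< t k r i j edge)) t≤i)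

thresholdAdj-row : ∀ {n} T k r (j : Fin n) → thresholdAdj (suc T) (suc k) r zero (suc j) ≡ (toℕ j <ᵇ T)
thresholdAdj-row T k r j = trans (∨-identityʳ _) (∧-identityʳ _)

<ᵇ∧<ᵇ≡<ᵇ : ∀ j {r T} → r ≤ T → ((j <ᵇ T) ∧ (j <ᵇ r)) ≡ (j <ᵇ r)
<ᵇ∧<ᵇ≡<ᵇ j       {zero}              _         = ∧-zeroʳ _
<ᵇ∧<ᵇ≡<ᵇ zero    {suc r} {suc T} _         = refl
<ᵇ∧<ᵇ≡<ᵇ (suc j) {suc r} {suc T} (s≤s r≤T) = <ᵇ∧<ᵇ≡<ᵇ j r≤T

thresholdAdj-row₀ : ∀ {n} T r (j : Fin n) → r ≤ T → thresholdAdj (suc T) 0 r zero (suc j) ≡ (toℕ j <ᵇ r)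
thresholdAdj-row₀ T r j r≤T = trans (∨-identityʳ _) (<ᵇ∧<ᵇ≡<ᵇ (toℕ j) r≤T)

-- the number of pairs {i < j} ⊆ [t] with i < k: these are the first edges in the lex order
prefixEdges : ℕ → ℕ → ℕ
prefixEdges t       zero    = 0
prefixEdges zero    (suc k) = 0
prefixEdges (suc t) (suc k) = t + prefixEdges t k

countPairs-threshold : ∀ {n t} k r s e → t ≡ k + suc (r + s) → n ≡ t + e →
  countPairs n (thresholdAdj t k r) ≡ prefixEdges t k + r
countPairs-threshold zero r s e refl refl = begin
  sum (tabulate {n = r + s + e} λ j → indicator (thresholdAdj (suc (r + s)) 0 r zero (suc j))) + countPairs (r + s + e) edgeless
    ≡⟨ cong₂ _+_ (sum-tabulate-cong (r + s + e) (λ j → cong indicator (thresholdAdj-row₀ (r + s) r j (m≤m+n r s))))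
                 (countPairs-empty (r + s + e)) ⟩
  sum (tabulate {n = r + s + e} λ j → indicator (toℕ j <ᵇ r)) + 0
    ≡⟨ trans (+-identityʳ _) (sum-indicator-<ᵇ (r + s + e) r (≤-trans (m≤m+n r s) (m≤m+n (r + s) e))) ⟩
  r ∎
  where open ≡-Reasoning
countPairs-threshold (suc k) r s e refl refl = begin
  sum (tabulate {n = T + e} λ j → indicator (thresholdAdj (suc T) (suc k) r zero (suc j))) + countPairs (T + e) (thresholdAdj T k r)
    ≡⟨ cong₂ _+_ (sum-tabulate-cong (T + e) (λ j → cong indicator (thresholdAdj-row T k r j)))
                 (countPairs-threshold k r s e refl refl) ⟩
  sum (tabulate {n = T + e} λ j → indicator (toℕ j <ᵇ T)) + (prefixEdges T k + r)
    ≡⟨ cong (_+ (prefixEdges T k + r)) (sum-indicator-<ᵇ (T + e) T (m≤m+n T e)) ⟩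
  T + (prefixEdges T k + r)
    ≡⟨ +-assoc T (prefixEdges T k) r ⟨
  T + prefixEdges T k + r ∎
  where
  open ≡-Reasoning
  T = k + suc (r + s)

thresholdHoms : ℕ → ℕ → ℕ → ℕ
thresholdHoms k r s = k + 2 ^ s + 2 ^ (r + s)

homsWith-threshold-forcedB : ∀ {n} t k r e → n ≡ t + e → homsWith n (thresholdAdj t k r) (restriction t t) ≡ 3 ^ e
homsWith-threshold-forcedB {n} t k r e n≡t+e =
  trans (homsWith-forcedB n (thresholdAdj t k r) t t (thresholdAdj-< t k r))
        (trans (homsWith-edgeless-restriction t 0 e (sym (+-identityʳ t)) n≡t+e) (*-identityˡ _))

homsWith-threshold-avoidC : ∀ {n t} k r s e → t ≡ k + suc (r + s) → n ≡ t + e →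
  homsWith n (thresholdAdj t k r) (restriction 0 t) ≡ thresholdHoms k r s * 3 ^ e
homsWith-threshold-avoidC zero r s e refl refl =
  trans (homsWith-suc (T + e) (thresholdAdj (suc T) 0 r) (restriction 0 (suc T)))
        (trans (cong₂ (λ x y → 1 * x + (1 * y + 0)) firstToA firstToB) (collect (2 ^ s) (2 ^ (r + s)) (3 ^ e)))
  where
  open ≡-Reasoning
  T = r + s
  r≤T = m≤m+n r s
  H = homsWith (T + e) edgeless
  rest : JV → Fin (T + e) → JV → Bool
  rest v j w = restriction 0 T j w ∧ (not (thresholdAdj (suc T) 0 r zero (suc j)) ∨ Jadj v w)
  row : ∀ j → thresholdAdj (suc T) 0 r zero (suc j) ≡ (toℕ j <ᵇ r)
  row j = thresholdAdj-row₀ T r j r≤T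
  firstToA : H (rest a) ≡ 2 ^ s * 3 ^ e
  firstToA = begin
    H (rest a)                 ≡⟨ homsWith-cong (T + e) (λ _ _ → refl) (restriction-∧-neighbourOf-a 0 T r row) ⟩
    H (restriction r (T ⊔ r))  ≡⟨ cong (λ y → H (restriction r y)) (m≥n⇒m⊔n≡m r≤T) ⟩
    H (restriction r T)        ≡⟨ homsWith-edgeless-restriction r s e refl refl ⟩
    2 ^ s * 3 ^ e              ∎
  firstToB : H (rest b) ≡ 2 ^ (r + s) * 3 ^ e
  firstToB = begin
    H (rest b)                 ≡⟨ homsWith-cong (T + e) (λ _ _ → refl) (restriction-∧-neighbourOf-b 0 T r row) ⟩
    H (restriction 0 (T ⊔ r))  ≡⟨ cong (λ y → H (restriction 0 y)) (m≥n⇒m⊔n≡m r≤T) ⟩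
    H (restriction 0 T)        ≡⟨ homsWith-edgeless-restriction 0 (r + s) e refl refl ⟩
    2 ^ (r + s) * 3 ^ e        ∎
  collect : ∀ u v w → 1 * (u * w) + (1 * (v * w) + 0) ≡ (0 + u + v) * w
  collect = solve-∀
homsWith-threshold-avoidC (suc k) r s e refl refl =
  trans (homsWith-suc (T + e) (thresholdAdj (suc T) (suc k) r) (restriction 0 (suc T)))
        (trans (cong₂ (λ x y → 1 * x + (1 * y + 0)) firstToA firstToB) (collect k (2 ^ s) (2 ^ (r + s)) (3 ^ e)))
  where
  open ≡-Reasoning
  T = k + suc (r + s)
  H = homsWith (T + e) (thresholdAdj T k r)
  rest : JV → Fin (T + e) → JV → Bool
  rest v j w = restriction 0 T j w ∧ (not (thresholdAdj (suc T) (suc k) r zero (suc j)) ∨ Jadj v w)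
  row : ∀ j → thresholdAdj (suc T) (suc k) r zero (suc j) ≡ (toℕ j <ᵇ T)
  row = thresholdAdj-row T k r
  firstToA : H (rest a) ≡ 3 ^ e
  firstToA = begin
    H (rest a)                 ≡⟨ homsWith-cong (T + e) (λ _ _ → refl) (restriction-∧-neighbourOf-a 0 T T row) ⟩
    H (restriction T (T ⊔ T))  ≡⟨ cong (λ y → H (restriction T y)) (⊔-idem T) ⟩
    H (restriction T T)        ≡⟨ homsWith-threshold-forcedB T k r e refl ⟩
    3 ^ e                      ∎
  firstToB : H (rest b) ≡ thresholdHoms k r s * 3 ^ e
  firstToB = begin
    H (rest b)                 ≡⟨ homsWith-cong (T + e) (λ _ _ → refl) (restriction-∧-neighbourOf-b 0 T T row) ⟩
    H (restriction 0 (T ⊔ T))  ≡⟨ cong (λ y → H (restriction 0 y)) (⊔-idem T) ⟩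
    H (restriction 0 T)        ≡⟨ homsWith-threshold-avoidC k r s e refl refl ⟩
    thresholdHoms k r s * 3 ^ e ∎
  collect : ∀ k u v w → 1 * w + (1 * ((k + u + v) * w) + 0) ≡ (1 + k + u + v) * w
  collect = solve-∀

-- With k ≥ 1, vertex 0 is adjacent to every vertex below t, so it cannot be sent to c.
homsWith-threshold : ∀ {n t} k r s e → t ≡ suc k + suc (r + s) → n ≡ t + e →
  homsWith n (thresholdAdj t (suc k) r) (restriction 0 0) ≡ thresholdHoms (suc k) r s * 3 ^ e
homsWith-threshold k r s e refl refl =
  trans (homsWith-suc (T + e) (thresholdAdj (suc T) (suc k) r) (restriction 0 0))
        (trans (cong₂ _+_ (cong (1 *_) firstToA) (cong₂ _+_ (cong (1 *_) firstToB) (cong (1 *_) firstToC)))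
               (collect k (2 ^ s) (2 ^ (r + s)) (3 ^ e)))
  where
  T = k + suc (r + s)
  row : ∀ j → thresholdAdj (suc T) (suc k) r zero (suc j) ≡ (toℕ j <ᵇ T)
  row = thresholdAdj-row T k r
  rest : JV → Fin (T + e) → JV → Bool
  rest v j w = restriction 0 0 j w ∧ (not (thresholdAdj (suc T) (suc k) r zero (suc j)) ∨ Jadj v w)
  firstToA : homsWith (T + e) (thresholdAdj T k r) (rest a) ≡ 3 ^ e
  firstToA = trans (homsWith-cong (T + e) (λ _ _ → refl) (restriction-∧-neighbourOf-a 0 0 T row))
                   (homsWith-threshold-forcedB T k r e refl)
  firstToB : homsWith (T + e) (thresholdAdj T k r) (rest b) ≡ thresholdHoms k r s * 3 ^ e
  firstToB = trans (homsWith-cong (T + e) (λ _ _ → refl) (restriction-∧-neighbourOf-b 0 0 T row))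
                   (homsWith-threshold-avoidC k r s e refl refl)
  0<T : 0 < T
  0<T = <-≤-trans (s≤s z≤n) (m≤n+m (suc (r + s)) k)
  first : Fin (T + e)
  first = fromℕ< (<-≤-trans 0<T (m≤m+n T e))
  firstToC : homsWith (T + e) (thresholdAdj T k r) (rest c) ≡ 0
  firstToC = homsWith-blocked (T + e) (thresholdAdj T k r) (rest c) first λ w →
    trans (cong (restriction 0 0 first w ∧_) (trans (neighbourOf-c _ w) (cong not first<T)))
          (∧-zeroʳ _)
    where
    first<T : thresholdAdj (suc T) (suc k) r zero (suc first) ≡ true
    first<T = trans (row first) (trans (cong (_<ᵇ T) (toℕ-fromℕ< _)) (<⇒<ᵇ≡true 0<T))
  collect : ∀ k u v w → 1 * w + (1 * ((k + u + v) * w) + 1 * 0) ≡ (1 + k + u + v) * w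
  collect = solve-∀

jHom-threshold : ∀ {n t} (G : SimpleGraph n) k r s e → (∀ i j → adj G i j ≡ thresholdAdj t (suc k) r i j) →
  t ≡ suc k + suc (r + s) → n ≡ t + e → jHom G ≡ thresholdHoms (suc k) r s * 3 ^ e
jHom-threshold {n} G k r s e G≈ t≡ n≡ = begin
  jHom G                                                   ≡⟨ jHom≡homsWith G ⟩
  homsWith n (adj G) (λ _ _ → true)                        ≡⟨ homsWith-cong n G≈ (λ _ → unrestricted) ⟩
  homsWith n (thresholdAdj _ (suc k) r) (restriction 0 0)  ≡⟨ homsWith-threshold k r s e t≡ n≡ ⟩
  thresholdHoms (suc k) r s * 3 ^ e                        ∎
  where
  open ≡-Reasoning
  unrestricted : ∀ w → true ≡ allowed false false w
  unrestricted a = refl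
  unrestricted b = refl
  unrestricted c = refl

edgeCount-threshold : ∀ {n t} (G : SimpleGraph n) k r s e → (∀ i j → adj G i j ≡ thresholdAdj t k r i j) →
  t ≡ k + suc (r + s) → n ≡ t + e → edgeCount G ≡ prefixEdges t k + r
edgeCount-threshold {n} G k r s e G≈ t≡ n≡ =
  trans (edgeCount≡countPairs G) (trans (countPairs-cong n (λ i j _ → G≈ i j)) (countPairs-threshold k r s e t≡ n≡))

-- Lex graphs as threshold graphs

lexPairᵇ : ℕ → ℕ → ℕ → ℕ → Bool
lexPairᵇ i j x y = (i <ᵇ x) ∨ ((i ≡ᵇ x) ∧ (j <ᵇ y))

pair : ∀ {q} → Fin q → Fin q → Subset q
pair i j = ⁅ i ⁆ ∪ ⁅ j ⁆

lexLess-irrefl : ∀ {k} (v : Vec Bool k) → lexLess v v ≡ false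
lexLess-irrefl []          = refl
lexLess-irrefl (true ∷ v)  = lexLess-irrefl v
lexLess-irrefl (false ∷ v) = lexLess-irrefl v

lexLess-⁅⁆ : ∀ {q} (j y : Fin q) → lexLess ⁅ j ⁆ ⁅ y ⁆ ≡ (toℕ j <ᵇ toℕ y)
lexLess-⁅⁆ {suc q} zero zero = lexLess-irrefl (⊥ {q})
lexLess-⁅⁆ zero    (suc y)   = refl
lexLess-⁅⁆ (suc j) zero      = refl
lexLess-⁅⁆ (suc j) (suc y)   = lexLess-⁅⁆ j y

lexLess-pair : ∀ {q} (i j x y : Fin q) → toℕ i < toℕ j → toℕ x < toℕ y →
  lexLess (pair i j) (pair x y) ≡ lexPairᵇ (toℕ i) (toℕ j) (toℕ x) (toℕ y)
lexLess-pair zero    (suc j) zero    (suc y) _ _ =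
  trans (cong₂ lexLess (∪-identityˡ ⁅ j ⁆) (∪-identityˡ ⁅ y ⁆)) (lexLess-⁅⁆ j y)
lexLess-pair zero    (suc j) (suc x) (suc y) _ _ = refl
lexLess-pair (suc i) (suc j) zero    (suc y) _ _ = refl
lexLess-pair (suc i) (suc j) (suc x) (suc y) (s≤s i<j) (s≤s x<y) = lexLess-pair i j x y i<j x<y

-- the pairs preceding {x, x + 1 + d} are the edges of a threshold graph
threshold≡lexPairᵇ : ∀ q i j x d → i < j → j < q → threshold q x d i j ≡ lexPairᵇ i j x (x + suc d)
threshold≡lexPairᵇ q       zero    (suc j) zero    d _ j<q rewrite <⇒<ᵇ≡true j<q = refl
threshold≡lexPairᵇ q       zero    (suc j) (suc x) d _ j<q rewrite <⇒<ᵇ≡true j<q = refl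
threshold≡lexPairᵇ q       (suc i) j       zero    d _ _   = refl
threshold≡lexPairᵇ (suc q) (suc i) (suc j) (suc x) d (s≤s i<j) (s≤s j<q) = threshold≡lexPairᵇ q i j x d i<j j<q

lexRank-pair : ∀ q (x y : Fin q) d → toℕ y ≡ toℕ x + suc d → lexRank (pair x y) ≡ prefixEdges q (toℕ x) + d
lexRank-pair q x y d y≡ = begin
  count (λ B → lexLess B (pair x y)) (twoSubsets q)
    ≡⟨ count-map (λ B → lexLess B (pair x y)) (λ p → pair (proj₁ p) (proj₂ p)) (filterᵇ increasing (allPairs q)) ⟩
  count (λ p → lexLess (pair (proj₁ p) (proj₂ p)) (pair x y)) (filterᵇ increasing (allPairs q))
    ≡⟨ count-filterᵇ (λ p → lexLess (pair (proj₁ p) (proj₂ p)) (pair x y)) increasing (allPairs q) ⟩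
  count (λ p → increasing p ∧ lexLess (pair (proj₁ p) (proj₂ p)) (pair x y)) (allPairs q)
    ≡⟨ count-allPairs q (λ i j → lexLess (pair i j) (pair x y)) ⟩
  countPairs q (λ i j → lexLess (pair i j) (pair x y))
    ≡⟨ countPairs-cong q precedes≡edge ⟩
  countPairs q (thresholdAdj q (toℕ x) d)
    ≡⟨ countPairs-threshold (toℕ x) d (suc s) 0 q≡ (sym (+-identityʳ q)) ⟩
  prefixEdges q (toℕ x) + d ∎
  where
  open ≡-Reasoning
  increasing : Fin q × Fin q → Bool
  increasing p = toℕ (proj₁ p) <ᵇ toℕ (proj₂ p)
  s = proj₁ (m≤n⇒∃[o]m+o≡n (toℕ<n y))
  q≡ : q ≡ toℕ x + suc (d + suc s)
  q≡ = begin
    q                          ≡⟨ proj₂ (m≤n⇒∃[o]m+o≡n (toℕ<n y)) ⟨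
    suc (toℕ y) + s            ≡⟨ cong (λ z → suc z + s) y≡ ⟩
    suc (toℕ x + suc d) + s    ≡⟨ shuffle (toℕ x) d s ⟩
    toℕ x + suc (d + suc s)    ∎
    where
    shuffle : ∀ x d s → suc (x + suc d) + s ≡ x + suc (d + suc s)
    shuffle = solve-∀
  x<y : toℕ x < toℕ y
  x<y = subst (toℕ x <_) (sym y≡) (m<m+n (toℕ x) (s≤s z≤n))
  precedes≡edge : ∀ i j → toℕ i < toℕ j → lexLess (pair i j) (pair x y) ≡ thresholdAdj q (toℕ x) d i j
  precedes≡edge i j i<j = begin
    lexLess (pair i j) (pair x y)                                ≡⟨ lexLess-pair i j x y i<j x<y ⟩
    lexPairᵇ (toℕ i) (toℕ j) (toℕ x) (toℕ y)                     ≡⟨ cong (lexPairᵇ (toℕ i) (toℕ j) (toℕ x)) y≡ ⟩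
    lexPairᵇ (toℕ i) (toℕ j) (toℕ x) (toℕ x + suc d)             ≡⟨ threshold≡lexPairᵇ q _ _ (toℕ x) d i<j (toℕ<n j) ⟨
    threshold q (toℕ x) d (toℕ i) (toℕ j)                        ≡⟨ thresholdAdj≡threshold q (toℕ x) d i j i<j ⟨
    thresholdAdj q (toℕ x) d i j                                 ∎

<ᵇ-cancelˡ : ∀ w u v → (w + u <ᵇ w + v) ≡ (u <ᵇ v)
<ᵇ-cancelˡ zero    u v = refl
<ᵇ-cancelˡ (suc w) u v = <ᵇ-cancelˡ w u v

lexRank<ᵇ≡threshold : ∀ t k r x d → x + suc d < t → r + k + 2 ≤ t →
  (prefixEdges t x + d <ᵇ prefixEdges t k + r) ≡ threshold t k r x (x + suc d)
lexRank<ᵇ≡threshold (suc t) zero    r zero    d (s≤s y<t) _ rewrite <⇒<ᵇ≡true y<t = refl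
lexRank<ᵇ≡threshold (suc t) (suc k) r zero    d (s≤s y<t) _ rewrite <⇒<ᵇ≡true y<t =
  <⇒<ᵇ≡true (<-≤-trans y<t (≤-trans (m≤m+n t (prefixEdges t k)) (m≤m+n _ r)))
lexRank<ᵇ≡threshold (suc t) zero    r (suc x) d _ r+2≤t = ≥⇒<ᵇ≡false (begin
  r                        ≤⟨ n≤1+n r ⟩
  suc r                    ≤⟨ ≤-pred (subst (_≤ suc t) (trans (cong (_+ 2) (+-identityʳ r)) (+-comm r 2)) r+2≤t) ⟩
  t                        ≤⟨ m≤m+n t _ ⟩
  t + prefixEdges t x      ≤⟨ m≤m+n _ d ⟩
  t + prefixEdges t x + d  ∎)
  where open ≤-Reasoning
lexRank<ᵇ≡threshold (suc t) (suc k) r (suc x) d (s≤s y<t) r+k+2≤t = begin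
  (t + prefixEdges t x + d <ᵇ t + prefixEdges t k + r)     ≡⟨ cong₂ _<ᵇ_ (+-assoc t _ d) (+-assoc t _ r) ⟩
  (t + (prefixEdges t x + d) <ᵇ t + (prefixEdges t k + r)) ≡⟨ <ᵇ-cancelˡ t _ _ ⟩
  (prefixEdges t x + d <ᵇ prefixEdges t k + r)             ≡⟨ lexRank<ᵇ≡threshold t k r x d y<t r+k+2≤t′ ⟩
  threshold t k r x (x + suc d)                            ∎
  where
  open ≡-Reasoning
  r+k+2≤t′ : r + k + 2 ≤ t
  r+k+2≤t′ = ≤-pred (subst (_≤ suc t) (cong (_+ 2) (+-suc r k)) r+k+2≤t)

lexAdj≡thresholdAdj-< : ∀ q m k r → m ≡ prefixEdges q k + r → r + k + 2 ≤ q → (x y : Fin q) → toℕ x < toℕ y →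
  lexAdj q m x y ≡ thresholdAdj q k r x y
lexAdj≡thresholdAdj-< q m k r m≡ r+k+2≤q x y x<y = begin
  neqᵇ x y ∧ (lexRank (pair x y) <ᵇ m)                ≡⟨ cong₂ (λ u v → u ∧ (v <ᵇ m)) x≢y (lexRank-pair q x y d y≡) ⟩
  (prefixEdges q (toℕ x) + d <ᵇ m)                    ≡⟨ cong (prefixEdges q (toℕ x) + d <ᵇ_) m≡ ⟩
  (prefixEdges q (toℕ x) + d <ᵇ prefixEdges q k + r)  ≡⟨ lexRank<ᵇ≡threshold q k r (toℕ x) d y<q r+k+2≤q ⟩
  threshold q k r (toℕ x) (toℕ x + suc d)             ≡⟨ cong (threshold q k r (toℕ x)) y≡ ⟨
  threshold q k r (toℕ x) (toℕ y)                     ≡⟨ thresholdAdj≡threshold q k r x y x<y ⟨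
  thresholdAdj q k r x y                              ∎
  where
  open ≡-Reasoning
  d = proj₁ (m≤n⇒∃[o]m+o≡n x<y)
  y≡ : toℕ y ≡ toℕ x + suc d
  y≡ = trans (sym (proj₂ (m≤n⇒∃[o]m+o≡n x<y))) (sym (+-suc (toℕ x) d))
  y<q : toℕ x + suc d < q
  y<q = subst (_< q) y≡ (toℕ<n y)
  x≢y : neqᵇ x y ≡ true
  x≢y with x ≟ y
  ... | yes refl = ⊥-elim (<-irrefl refl x<y)
  ... | no _     = refl

-- r + k + 2 ≤ q: vertex k misses a later vertex, so that it is not a dominating vertex.
lexAdj≡thresholdAdj : ∀ q m k r → m ≡ prefixEdges q k + r → r + k + 2 ≤ q → (x y : Fin q) →
  lexAdj q m x y ≡ thresholdAdj q k r x y
lexAdj≡thresholdAdj q m k r m≡ r+k+2≤q x y with <-cmp (toℕ x) (toℕ y)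
... | tri< x<y _ _ = lexAdj≡thresholdAdj-< q m k r m≡ r+k+2≤q x y x<y
... | tri≈ _ x≡y _ rewrite toℕ-injective x≡y =
  trans (cong (_∧ (lexRank (pair y y) <ᵇ m)) (neqᵇ-irr y)) (sym (thresholdAdj-irrefl q k r y))
... | tri> _ _ y<x =
  trans (adjSym (L q m) x y) (trans (lexAdj≡thresholdAdj-< q m k r m≡ r+k+2≤q y x y<x) (thresholdAdj-sym q k r y x))

thresholdAdj-toℕ : ∀ {n n′} t k r (i j : Fin n) (x y : Fin n′) → toℕ i ≡ toℕ x → toℕ j ≡ toℕ y →
  thresholdAdj t k r i j ≡ thresholdAdj t k r x y
thresholdAdj-toℕ t k r i j x y i≡x j≡y rewrite i≡x | j≡y = refl

splitAt-inj₁-toℕ : ∀ q {p} {i : Fin (q + p)} {x} → splitAt q i ≡ inj₁ x → toℕ i ≡ toℕ x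
splitAt-inj₁-toℕ q {p} {x = x} s = trans (cong toℕ (sym (splitAt⁻¹-↑ˡ s))) (toℕ-↑ˡ x p)

splitAt-inj₂-≤ : ∀ q {p} {i : Fin (q + p)} {x} → splitAt q i ≡ inj₂ x → q ≤ toℕ i
splitAt-inj₂-≤ q {x = x} s = subst (q ≤_) (trans (sym (toℕ-↑ʳ q x)) (cong toℕ (splitAt⁻¹-↑ʳ s))) (m≤m+n q (toℕ x))

R-adj≡thresholdAdj : ∀ n q m k r → m ≡ prefixEdges q k + r → r + k + 2 ≤ q → (i j : Fin (q + (n ∸ q))) →
  adj (R n q m) i j ≡ thresholdAdj q k r i j
R-adj≡thresholdAdj n q m k r m≡ r+k+2≤q i j with splitAt q i in si | splitAt q j in sj
... | inj₁ x | inj₁ y = trans (lexAdj≡thresholdAdj q m k r m≡ r+k+2≤q x y)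
                              (thresholdAdj-toℕ q k r x y i j (sym (splitAt-inj₁-toℕ q si)) (sym (splitAt-inj₁-toℕ q sj)))
... | inj₂ _ | inj₂ _ = sym (thresholdAdj-beyond q k r i j (splitAt-inj₂-≤ q si))
... | inj₂ _ | inj₁ _ = sym (thresholdAdj-beyond q k r i j (splitAt-inj₂-≤ q si))
... | inj₁ _ | inj₂ _ = sym (trans (thresholdAdj-sym q k r i j) (thresholdAdj-beyond q k r j i (splitAt-inj₂-≤ q sj)))

prefixEdges-suc : ∀ t k → k ≤ t → prefixEdges (suc t) k ≡ prefixEdges t k + k
prefixEdges-suc t       zero    _         = refl
prefixEdges-suc (suc t) (suc k) (s≤s k≤t) =
  trans (cong (suc t +_) (prefixEdges-suc t k k≤t)) (shuffle t (prefixEdges t k) k)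
  where
  shuffle : ∀ t F k → suc t + (F + k) ≡ t + F + suc k
  shuffle = solve-∀

prefixEdges-sucʳ : ∀ k x → prefixEdges (k + suc x) (suc k) ≡ prefixEdges (k + suc x) k + x
prefixEdges-sucʳ zero    x = +-identityʳ x
prefixEdges-sucʳ (suc k) x = trans (cong (k + suc x +_) (prefixEdges-sucʳ k x)) (sym (+-assoc (k + suc x) _ x))

prefixEdges-closed : ∀ t k → k ≤ t → 2 * prefixEdges t k + k * (1 + k) ≡ 2 * k * t
prefixEdges-closed t       zero    _         = sym (*-zeroˡ t)
prefixEdges-closed (suc t) (suc k) (s≤s k≤t) = begin
  2 * (t + prefixEdges t k) + suc k * (1 + suc k)       ≡⟨ shuffle t (prefixEdges t k) k ⟩
  (2 * prefixEdges t k + k * (1 + k)) + 2 * (t + suc k)  ≡⟨ cong (_+ 2 * (t + suc k)) (prefixEdges-closed t k k≤t) ⟩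
  2 * k * t + 2 * (t + suc k)                            ≡⟨ shuffle′ t k ⟩
  2 * suc k * suc t                                      ∎
  where
  open ≡-Reasoning
  shuffle : ∀ t F k → 2 * (t + F) + suc k * (1 + suc k) ≡ (2 * F + k * (1 + k)) + 2 * (t + suc k)
  shuffle = solve-∀
  shuffle′ : ∀ t k → 2 * k * t + 2 * (t + suc k) ≡ 2 * suc k * suc t
  shuffle′ = solve-∀

prefixEdges-diagonal : ∀ q → 2 * prefixEdges q q + q ≡ q * q
prefixEdges-diagonal zero    = refl
prefixEdges-diagonal (suc t) =
  trans (shuffle t (prefixEdges t t)) (trans (cong (_+ (2 * t + 1)) (prefixEdges-diagonal t)) (shuffle′ t))
  where
  shuffle : ∀ t F → 2 * (t + F) + suc t ≡ (2 * F + t) + (2 * t + 1)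
  shuffle = solve-∀
  shuffle′ : ∀ t → t * t + (2 * t + 1) ≡ suc t * suc t
  shuffle′ = solve-∀

-- In L(q, m), vertex k is joined to r of the later vertices and misses the other suc s.
record LexDecomposition (q m : ℕ) : Set where
  constructor lexDecomposition
  field
    k r s : ℕ
    q≡ : q ≡ k + suc (r + suc s)
    m≡ : m ≡ prefixEdges q k + r

lexDecompose : ∀ q m → m < prefixEdges q q → LexDecomposition q m
lexDecompose (suc t) m m< with m <? t
... | yes m<t = lexDecomposition 0 m s (cong suc (sym (trans (+-suc m s) t≡))) refl
  where
  s = proj₁ (m≤n⇒∃[o]m+o≡n m<t)
  t≡ = proj₂ (m≤n⇒∃[o]m+o≡n m<t)
... | no m≮t with lexDecompose t (m ∸ t) (+-cancelˡ-< t _ _ (subst (_< t + prefixEdges t t) (sym (m+[n∸m]≡n t≤m)) m<))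
  where
  t≤m = ≮⇒≥ m≮t
...   | lexDecomposition k r s t≡ m∸t≡ =
  lexDecomposition (suc k) r s (cong suc t≡)
    (trans (sym (m+[n∸m]≡n (≮⇒≥ m≮t))) (trans (cong (t +_) m∸t≡) (sym (+-assoc t _ r))))

≤-by-slack : ∀ {x y} d → x + d ≡ y → x ≤ y
≤-by-slack {x} d x+d≡y = subst (x ≤_) x+d≡y (m≤m+n x d)

square-bound-diagonal : ∀ q → 3 ≤ q → (2 * q ∸ 5) ^ 2 ≤ 9 + 24 * prefixEdges q q
square-bound-diagonal (suc (suc (suc q₀))) (s≤s (s≤s (s≤s _))) =
  +-cancelʳ-≤ (12 * q) _ _ (≤-by-slack slack (begin
    (2 * q ∸ 5) ^ 2 + 12 * q + slack     ≡⟨ cong (λ x → x ^ 2 + 12 * q + slack) 2q∸5≡ ⟩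
    (2 * q₀ + 1) ^ 2 + 12 * q + slack    ≡⟨ expand q₀ ⟩
    9 + 12 * (q * q)                     ≡⟨ cong (λ x → 9 + 12 * x) (prefixEdges-diagonal q) ⟨
    9 + 12 * (2 * prefixEdges q q + q)   ≡⟨ collect (prefixEdges q q) q ⟩
    9 + 24 * prefixEdges q q + 12 * q    ∎))
  where
  open ≡-Reasoning
  q = 3 + q₀
  slack = 8 * (q₀ * q₀) + 56 * q₀ + 80
  2q∸5≡ : 2 * q ∸ 5 ≡ 2 * q₀ + 1
  2q∸5≡ = trans (cong (_∸ 5) (shuffle q₀)) (m+n∸n≡m (2 * q₀ + 1) 5)
    where
    shuffle : ∀ x → 2 * (3 + x) ≡ 2 * x + 1 + 5
    shuffle = solve-∀
  expand : ∀ x → (2 * x + 1) * ((2 * x + 1) * 1) + 12 * (3 + x) + (8 * (x * x) + 56 * x + 80) ≡ 9 + 12 * ((3 + x) * (3 + x))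
  expand = solve-∀
  collect : ∀ F x → 9 + 12 * (2 * F + x) ≡ 9 + 24 * F + 12 * x
  collect = solve-∀

square-bound-core : ∀ k q → k + 3 ≤ q → q ≤ 3 * k + 7 → (2 * q ∸ 5) ^ 2 ≤ 9 + 24 * prefixEdges q (suc k)
square-bound-core k q k+3≤q q≤3k+7 with m≤n⇒∃[o]m+o≡n k+3≤q
... | p , refl = +-cancelʳ-≤ (12 * (suc k * (1 + suc k))) _ _ (begin
  (2 * q ∸ 5) ^ 2 + 12 * (suc k * (1 + suc k))          ≡⟨ cong (λ x → x ^ 2 + 12 * (suc k * (1 + suc k))) 2q∸5≡ ⟩
  (2 * k + 2 * p + 1) ^ 2 + 12 * (suc k * (1 + suc k))  ≡⟨ expand k p ⟩
  Q + 4 * (p * p)                                        ≤⟨ +-monoʳ-≤ Q (*-monoʳ-≤ 4 (*-monoʳ-≤ p p≤2k+4)) ⟩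
  Q + 4 * (p * (2 * k + 4))                              ≤⟨ m≤m+n _ slack ⟩
  Q + 4 * (p * (2 * k + 4)) + slack                      ≡⟨ expand′ k p ⟩
  9 + 12 * (2 * suc k * q)                               ≡⟨ cong (λ x → 9 + 12 * x) (prefixEdges-closed q (suc k) K≤q) ⟨
  9 + 12 * (2 * F + suc k * (1 + suc k))                 ≡⟨ collect F (suc k * (1 + suc k)) ⟩
  9 + 24 * F + 12 * (suc k * (1 + suc k))                ∎)
  where
  open ≤-Reasoning
  F = prefixEdges q (suc k)
  Q = 16 * (k * k) + 8 * (k * p) + 40 * k + 4 * p + 25
  slack = 8 * (k * k) + 56 * k + 8 * (k * p) + 4 * p + 56
  K≤q : suc k ≤ q
  K≤q = ≤-by-slack (2 + p) (shuffle k p)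
    where
    shuffle : ∀ x y → suc x + (2 + y) ≡ x + 3 + y
    shuffle = solve-∀
  p≤2k+4 : p ≤ 2 * k + 4
  p≤2k+4 = +-cancelˡ-≤ (k + 3) p (2 * k + 4) (subst (q ≤_) (shuffle k) q≤3k+7)
    where
    shuffle : ∀ x → 3 * x + 7 ≡ x + 3 + (2 * x + 4)
    shuffle = solve-∀
  2q∸5≡ : 2 * q ∸ 5 ≡ 2 * k + 2 * p + 1
  2q∸5≡ = trans (cong (_∸ 5) (shuffle k p)) (m+n∸n≡m (2 * k + 2 * p + 1) 5)
    where
    shuffle : ∀ x y → 2 * (x + 3 + y) ≡ 2 * x + 2 * y + 1 + 5
    shuffle = solve-∀
  expand : ∀ x y → (2 * x + 2 * y + 1) * ((2 * x + 2 * y + 1) * 1) + 12 * (suc x * (1 + suc x))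
                   ≡ 16 * (x * x) + 8 * (x * y) + 40 * x + 4 * y + 25 + 4 * (y * y)
  expand = solve-∀
  expand′ : ∀ x y → 16 * (x * x) + 8 * (x * y) + 40 * x + 4 * y + 25 + 4 * (y * (2 * x + 4))
                    + (8 * (x * x) + 56 * x + 8 * (x * y) + 4 * y + 56) ≡ 9 + 12 * (2 * suc x * (x + 3 + y))
  expand′ = solve-∀
  collect : ∀ x y → 9 + 12 * (2 * x + y) ≡ 9 + 24 * x + 12 * y
  collect = solve-∀

-- Comparison graphs

R-notExtremal : ∀ m q k r s t k′ r′ s′ → q ≡ suc k + suc (r + suc s) → m ≡ prefixEdges q (suc k) + r →
  q ≡ t + 2 → t ≡ suc k′ + suc (r′ + s′) → prefixEdges t (suc k′) + r′ ≡ m →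
  thresholdHoms (suc k) r (suc s) < 9 * thresholdHoms (suc k′) r′ s′ → ¬ IsJExtremal (R (suc m) q m)
R-notExtremal m q k r s t k′ r′ s′ q≡ m≡ q≡t+2 t≡ m≡′ fewerHoms extremal =
  <⇒≱ fewerHoms (*-cancelʳ-≤ _ _ (3 ^ e) {{m^n≢0 3 e}} homs)
  where
  e = suc m ∸ q
  G = R (suc m) q m
  G′ = Threshold (q + e) t (suc k′) r′
  q+e≡ : q + e ≡ t + (2 + e)
  q+e≡ = trans (cong (_+ e) q≡t+2) (+-assoc t 2 e)
  r+k+2≤q : r + suc k + 2 ≤ q
  r+k+2≤q = subst (r + suc k + 2 ≤_) (trans (shuffle r k s) (sym q≡)) (m≤m+n (r + suc k + 2) s)
    where
    shuffle : ∀ r k s → r + suc k + 2 + s ≡ suc k + suc (r + suc s)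
    shuffle = solve-∀
  G≈ : ∀ i j → adj G i j ≡ thresholdAdj q (suc k) r i j
  G≈ = R-adj≡thresholdAdj (suc m) q m (suc k) r m≡ r+k+2≤q
  sameEdges : edgeCount G′ ≡ edgeCount G
  sameEdges = begin
    edgeCount G′                  ≡⟨ edgeCount-threshold G′ (suc k′) r′ s′ (2 + e) (λ _ _ → refl) t≡ q+e≡ ⟩
    prefixEdges t (suc k′) + r′   ≡⟨ m≡′ ⟩
    m                             ≡⟨ m≡ ⟩
    prefixEdges q (suc k) + r     ≡⟨ edgeCount-threshold G (suc k) r (suc s) e G≈ q≡ refl ⟨
    edgeCount G                   ∎
    where open ≡-Reasoning
  homs : 9 * thresholdHoms (suc k′) r′ s′ * 3 ^ e ≤ thresholdHoms (suc k) r (suc s) * 3 ^ e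
  homs = subst₂ _≤_
    (trans (jHom-threshold G′ k′ r′ s′ (2 + e) (λ _ _ → refl) t≡ q+e≡) (shuffle (thresholdHoms (suc k′) r′ s′) (3 ^ e)))
    (jHom-threshold G k r (suc s) e G≈ q≡ refl)
    (extremal G′ sameEdges)
    where
    shuffle : ∀ h w → h * (3 * (3 * w)) ≡ 9 * h * w
    shuffle = solve-∀

-- keep the k + 1 dominating vertices and let vertex k + 1 take 2(k + 1) more neighbours
R-notExtremal-sameDominating : ∀ m q k r s → q ≡ suc k + suc (r + suc s) → m ≡ prefixEdges q (suc k) + r →
  2 * suc k < s → ¬ IsJExtremal (R (suc m) q m)
R-notExtremal-sameDominating m q k r s q≡ m≡ 2K<s with m≤n⇒∃[o]m+o≡n 2K<s
... | s′ , refl = R-notExtremal m q k r (suc (2 * K + s′)) t k (r + 2 * K) s′ q≡ m≡ q≡t+2 refl m≡′ fewerHoms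
  where
  K = suc k
  t = K + suc (r + 2 * K + s′)
  q≡t+2 : q ≡ t + 2
  q≡t+2 = trans q≡ (shuffle K r s′)
    where
    shuffle : ∀ x y z → x + suc (y + suc (suc (2 * x + z))) ≡ x + suc (y + 2 * x + z) + 2
    shuffle = solve-∀
  K≤t : K ≤ t
  K≤t = m≤m+n K _
  m≡′ : prefixEdges t K + (r + 2 * K) ≡ m
  m≡′ = sym (begin
    m                                ≡⟨ m≡ ⟩
    prefixEdges q K + r              ≡⟨ cong (λ x → prefixEdges x K + r) (trans q≡t+2 (+-comm t 2)) ⟩
    prefixEdges (suc (suc t)) K + r  ≡⟨ cong (_+ r) (prefixEdges-suc (suc t) K (≤-trans K≤t (n≤1+n t))) ⟩
    prefixEdges (suc t) K + K + r    ≡⟨ cong (λ x → x + K + r) (prefixEdges-suc t K K≤t) ⟩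
    prefixEdges t K + K + K + r      ≡⟨ shuffle (prefixEdges t K) K r ⟩
    prefixEdges t K + (r + 2 * K)    ∎)
    where
    open ≡-Reasoning
    shuffle : ∀ x y z → x + y + y + z ≡ x + (z + 2 * y)
    shuffle = solve-∀
  Y = 2 ^ (r + 2 * K + s′)
  4Y≡ : 2 ^ (r + suc (suc (2 * K + s′))) ≡ 4 * Y
  4Y≡ = trans (cong (2 ^_) (shuffle r (2 * K) s′)) (shuffle′ Y)
    where
    shuffle : ∀ x y z → x + suc (suc (y + z)) ≡ 2 + (x + y + z)
    shuffle = solve-∀
    shuffle′ : ∀ x → 2 * (2 * x) ≡ 4 * x
    shuffle′ = solve-∀
  fewerHoms : thresholdHoms K r (suc (suc (2 * K + s′))) < 9 * thresholdHoms K (r + 2 * K) s′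
  fewerHoms = subst (λ x → K + 2 ^ suc (suc (2 * K + s′)) + x < 9 * thresholdHoms K (r + 2 * K) s′) (sym 4Y≡)
    (bound K (2 ^ suc (suc (2 * K + s′))) (2 ^ s′) (subst (_ ≤_) 4Y≡ (^-monoʳ-≤ 2 (m≤n+m _ r))) (m^n>0 2 s′))
    where
    bound : ∀ x u z → u ≤ 4 * Y → 1 ≤ z → x + u + 4 * Y < 9 * (x + z + Y)
    bound x u (suc z) u≤4Y _ =
      ≤-trans (s≤s (+-monoˡ-≤ (4 * Y) (+-monoʳ-≤ x u≤4Y))) (≤-by-slack (8 * x + 9 * z + 8 + Y) (shuffle x z Y))
      where
      shuffle : ∀ x z y → suc (x + 4 * y + 4 * y) + (8 * x + 9 * z + 8 + y) ≡ 9 * (x + suc z + y)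
      shuffle = solve-∀

3+o≤remainder : ∀ q k r s o → q ≡ suc k + suc (r + suc s) → s + o ≡ 2 * suc k → 3 * k + 7 < q → 3 + o ≤ r
3+o≤remainder q k r s o q≡ s+o≡2K 3k+7<q = +-cancelˡ-≤ (suc k + 2 + s) (3 + o) r (begin
  suc k + 2 + s + (3 + o)  ≡⟨ shuffle (suc k) s o ⟩
  suc k + 5 + (s + o)      ≡⟨ cong (suc k + 5 +_) s+o≡2K ⟩
  suc k + 5 + 2 * suc k    ≡⟨ shuffle′ k ⟩
  suc (3 * k + 7)          ≤⟨ 3k+7<q ⟩
  q                        ≡⟨ trans q≡ (shuffle″ (suc k) r s) ⟩
  suc k + 2 + s + r        ∎)
  where
  open ≤-Reasoning
  shuffle : ∀ x y z → x + 2 + y + (3 + z) ≡ x + 5 + (y + z)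
  shuffle = solve-∀
  shuffle′ : ∀ x → suc x + 5 + 2 * suc x ≡ suc (3 * x + 7)
  shuffle′ = solve-∀
  shuffle″ : ∀ x y z → x + suc (y + suc z) ≡ x + 2 + z + y
  shuffle″ = solve-∀

-- add vertex k + 1 to the dominating vertices and give vertex k + 2 the leftover edges
R-notExtremal-moreDominating : ∀ m q k r s → q ≡ suc k + suc (r + suc s) → m ≡ prefixEdges q (suc k) + r →
  s ≤ 2 * suc k → 3 * k + 7 < q → ¬ IsJExtremal (R (suc m) q m)
R-notExtremal-moreDominating m q k r s q≡ m≡ s≤2K 3k+7<q with m≤n⇒∃[o]m+o≡n s≤2K
... | o , s+o≡2K with m≤n⇒∃[o]m+o≡n (3+o≤remainder q k r s o q≡ s+o≡2K 3k+7<q)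
...   | w , refl = R-notExtremal m q k (3 + o + w) s t K (suc o) (w + s) q≡ m≡ q≡t+2 refl m≡′ fewerHoms
  where
  K = suc k
  t = suc K + suc (suc o + (w + s))
  q≡t+2 : q ≡ t + 2
  q≡t+2 = trans q≡ (shuffle K o w s)
    where
    shuffle : ∀ x y z u → x + suc (3 + y + z + suc u) ≡ suc x + suc (suc y + (z + u)) + 2
    shuffle = solve-∀
  K≤t : K ≤ t
  K≤t = ≤-trans (n≤1+n K) (m≤m+n (suc K) _)
  m≡′ : prefixEdges t (suc K) + suc o ≡ m
  m≡′ = begin
    prefixEdges t (suc K) + suc o                   ≡⟨ cong (λ x → prefixEdges x (suc K) + suc o) t≡ ⟩
    prefixEdges (K + suc x) (suc K) + suc o         ≡⟨ cong (_+ suc o) (prefixEdges-sucʳ K x) ⟩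
    prefixEdges (K + suc x) K + x + suc o           ≡⟨ cong (λ y → prefixEdges y K + x + suc o) (sym t≡) ⟩
    prefixEdges t K + x + suc o                     ≡⟨ shuffle (prefixEdges t K) o w s ⟩
    prefixEdges t K + (s + o) + (3 + o + w)         ≡⟨ cong (λ y → prefixEdges t K + y + (3 + o + w)) s+o≡2K ⟩
    prefixEdges t K + 2 * K + (3 + o + w)           ≡⟨ shuffle′ (prefixEdges t K) K (3 + o + w) ⟩
    prefixEdges t K + K + K + (3 + o + w)           ≡⟨ cong (λ y → y + K + (3 + o + w)) (prefixEdges-suc t K K≤t) ⟨
    prefixEdges (suc t) K + K + (3 + o + w)         ≡⟨ cong (_+ (3 + o + w)) (prefixEdges-suc (suc t) K (≤-trans K≤t (n≤1+n t))) ⟨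
    prefixEdges (suc (suc t)) K + (3 + o + w)       ≡⟨ cong (λ y → prefixEdges y K + (3 + o + w)) (trans q≡t+2 (+-comm t 2)) ⟨
    prefixEdges q K + (3 + o + w)                   ≡⟨ m≡ ⟨
    m                                               ∎
    where
    open ≡-Reasoning
    x = suc (suc o + (w + s))
    t≡ : t ≡ K + suc x
    t≡ = sym (+-suc K x)
    shuffle : ∀ F y z u → F + suc (suc y + (z + u)) + suc y ≡ F + (u + y) + (3 + y + z)
    shuffle = solve-∀
    shuffle′ : ∀ F y z → F + 2 * y + z ≡ F + y + y + z
    shuffle′ = solve-∀
  Y = 2 ^ (suc o + (w + s))
  8Y≡ : 2 ^ (3 + o + w + suc s) ≡ 8 * Y
  8Y≡ = trans (cong (2 ^_) (shuffle o w s)) (shuffle′ Y)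
    where
    shuffle : ∀ x y z → 3 + x + y + suc z ≡ 3 + (suc x + (y + z))
    shuffle = solve-∀
    shuffle′ : ∀ x → 2 * (2 * (2 * x)) ≡ 8 * x
    shuffle′ = solve-∀
  fewerHoms : thresholdHoms K (3 + o + w) (suc s) < 9 * thresholdHoms (suc K) (suc o) (w + s)
  fewerHoms = subst (λ x → K + 2 ^ suc s + x < 9 * thresholdHoms (suc K) (suc o) (w + s)) (sym 8Y≡)
    (bound K (2 ^ suc s) (2 ^ (w + s)) (^-monoʳ-≤ 2 (s≤s (≤-trans (m≤n+m s w) (m≤n+m (w + s) o)))))
    where
    bound : ∀ x u z → u ≤ Y → x + u + 8 * Y < 9 * (suc x + z + Y)
    bound x u z u≤Y =
      ≤-trans (s≤s (+-monoˡ-≤ (8 * Y) (+-monoʳ-≤ x u≤Y))) (≤-by-slack (8 * x + 8 + 9 * z) (shuffle x z Y))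
      where
      shuffle : ∀ x z y → suc (x + y + 8 * y) + (8 * x + 8 + 9 * z) ≡ 9 * (suc x + z + y)
      shuffle = solve-∀

bound-from-lexDecomposition : ∀ m q k r s → q ≡ suc k + suc (r + suc s) → m ≡ prefixEdges q (suc k) + r →
  IsJExtremal (R (suc m) q m) → (2 * q ∸ 5) ^ 2 ≤ 9 + 24 * m
bound-from-lexDecomposition m q k r s q≡ m≡ extremal with 2 * suc k <? s | q ≤? 3 * k + 7
... | yes 2K<s | _       = ⊥-elim (R-notExtremal-sameDominating m q k r s q≡ m≡ 2K<s extremal)
... | no 2K≮s  | no q≰   = ⊥-elim (R-notExtremal-moreDominating m q k r s q≡ m≡ (≮⇒≥ 2K≮s) (≰⇒> q≰) extremal)
... | no _     | yes q≤  = ≤-trans (square-bound-core k q k+3≤q q≤) (+-monoʳ-≤ 9 (*-monoʳ-≤ 24 F≤m))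
  where
  k+3≤q : k + 3 ≤ q
  k+3≤q = ≤-by-slack (r + s) (trans (shuffle k r s) (sym q≡))
    where
    shuffle : ∀ x y z → x + 3 + (y + z) ≡ suc x + suc (y + suc z)
    shuffle = solve-∀
  F≤m : prefixEdges q (suc k) ≤ m
  F≤m = ≤-by-slack r (sym m≡)

theorem4p4 : (m q : ℕ) → 1 ≤ m → q ≤ suc m → m ≤ q C 2 →
    IsJExtremal (R (suc m) q m) → (2 * q ∸ 5) ^ 2 ≤ 9 + 24 * m
theorem4p4 m 0 _ _ _ _ = z≤n
theorem4p4 m 1 _ _ _ _ = z≤n
theorem4p4 m 2 _ _ _ _ = z≤n
theorem4p4 m q@(suc (suc (suc _))) _ q≤1+m _ extremal with m <? prefixEdges q q
... | no m≮F = ≤-trans (square-bound-diagonal q (s≤s (s≤s (s≤s z≤n)))) (+-monoʳ-≤ 9 (*-monoʳ-≤ 24 (≮⇒≥ m≮F)))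
... | yes m<F with lexDecompose q m m<F
...   | lexDecomposition (suc k) r s q≡ m≡ = bound-from-lexDecomposition m q k r s q≡ m≡ extremal
-- without dominating vertices L(q, m) has m ≤ q - 2 edges, too few for q ≤ m + 1
...   | lexDecomposition zero    r s q≡ refl = ⊥-elim (<⇒≱ (subst (suc r <_) (sym q≡) (s≤s (m<m+n r (s≤s z≤n)))) q≤1+m)
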